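{- Let $(X,A,m,\alpha)$ be a micro-macro system and $0<\varepsilon<\frac12$. Suppose there is a map $t:A\to A$ with $[\alpha]_{a,t(a)}\ge 1-\varepsilon$ for all $a\in A$, and suppose that for all $a,b\in A$, $S(a)<S(b)$ implies $S(a)<S(b)+\ln(1-\varepsilon)$. Then $\frac{|D|}{|X|}\le\varepsilon$.
   Context: A micro-macro system $(X,A,m,\alpha)$ consists of finite sets $X$, $A$, a bijection $\alpha:X\to X$ and a surjection $m:X\to A$; identify $a\in A$ with $m^{ -1}(a)$, $|a|=|m^{ -1}(a)|$, $S(a)=\ln|a|$, $S(i)=\ln|m(i)|$ for $i\in X$. The transition probability is $[\alpha]_{ab}=\frac{|\{i\in a:\alpha(i)\in b\}|}{|a|}$. $D=\{i\in X: S(\alpha i)<S(i)\}$.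
   Formalization: The parameter ε ranges over the rationals strictly between 0 and ½. -}

module Defs where

open import Data.Nat using (ℕ; zero; suc)
open import Data.Fin using (Fin; _≟_)
open import Data.Integer using (+_)
open import Data.List using (length; filter; allFin)
open import Data.Rational using (ℚ; _/_; 0ℚ)
open import Data.Nat using (_<?_)
open import Relation.Nullary.Decidable using (_×-dec_)

-- Micro-macro system data: X = Fin n, A = Fin k, m : X → A, α : X → X.

size : ∀ {n k} → (Fin n → Fin k) → Fin k → ℕ
size {n} m a = length (filter (λ i → m i ≟ a) (allFin n))

transCount : ∀ {n k} → (Fin n → Fin k) → (Fin n → Fin n) → Fin k → Fin k → ℕ
transCount {n} m α a b =
  length (filter (λ i → (m i ≟ a) ×-dec (m (α i) ≟ b)) (allFin n))

-- p / q as a rational, with the (never used) convention p / 0 = 0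
frac : ℕ → ℕ → ℚ
frac p zero = 0ℚ
frac p (suc q) = (+ p) / suc q

transProb : ∀ {n k} → (Fin n → Fin k) → (Fin n → Fin n) → Fin k → Fin k → ℚ
transProb m α a b = frac (transCount m α a b) (size m a)

-- |D| where D = { i : S(α i) < S(i) }, i.e. |m(α i)| < |m(i)| (ln strictly monotone)
sizeD : ∀ {n k} → (Fin n → Fin k) → (Fin n → Fin n) → ℕ
sizeD {n} m α = length (filter (λ i → size m (m (α i)) <? size m (m i)) (allFin n))

ofℕ : ℕ → ℚ
ofℕ p = (+ p) / 1

-- Since α is injective, at most |t a| points of a can move into t a; as at least
-- (1 - ε)|a| of them do, |t a| < |a| would give S(t a) < S(a) + ln(1 - ε), which the
-- entropy-gap hypothesis forbids.  So S never decreases along the most likely transition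
-- t, every point of D is a point i with m (α i) ≠ t (m i), and each macrostate a has at
-- most ε|a| of those: |D| ≤ ε Σ|a| = ε|X|.  Writing ε = P/Q and 1 - ε = R/Q reduces all
-- of this to inequalities between natural numbers.
module Submission where

open import Defs

module Counting where

  open import Data.Bool using (Bool; true; false; _∧_; not)
  open import Data.Bool.Properties using (∧-identityʳ)
  open import Data.Empty using (⊥-elim)
  open import Data.Fin using (Fin; zero; suc; _≟_)
  open import Data.Fin.Permutation using (Permutation′; _⟨$⟩ʳ_)
  open import Data.List using (length; filter; tabulate)
  open import Data.Nat using (ℕ; zero; suc; z≤n; _≤_; _+_)
  open import Data.Nat.Properties using (≤-refl; +-mono-≤; +-identityʳ; +-*-semiring)
  open import Algebra.Properties.Semiring.Sum +-*-semiring
    using (sum; sum-syntax; sum-cong-≗; sum-replicate-zero; ∑-distrib-+; ∑-comm; ∑-permute)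
  open import Function using (_∘_)
  open import Relation.Nullary using (Dec; yes; no; does)
  open import Relation.Unary using (Pred; Decidable)
  open import Relation.Binary.PropositionalEquality using (_≡_; refl; sym; trans; cong)
  open Relation.Binary.PropositionalEquality.≡-Reasoning

  indicator : Bool → ℕ
  indicator true  = 1
  indicator false = 0

  count : ∀ {n} → (Fin n → Bool) → ℕ
  count {n} p = ∑[ i < n ] indicator (p i)

  length-filter-tabulate : ∀ {a p} {A : Set a} {P : Pred A p} (P? : Decidable P) {n} (f : Fin n → A) →
                           length (filter P? (tabulate f)) ≡ count (does ∘ P? ∘ f)
  length-filter-tabulate P? {zero}  f = refl
  length-filter-tabulate P? {suc n} f with does (P? (f zero))
  ... | true  = cong suc (length-filter-tabulate P? (f ∘ suc))
  ... | false = length-filter-tabulate P? (f ∘ suc)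

  ∑-mono-≤ : ∀ {n} {f g : Fin n → ℕ} → (∀ i → f i ≤ g i) → sum f ≤ sum g
  ∑-mono-≤ {zero}  f≤g = z≤n
  ∑-mono-≤ {suc n} f≤g = +-mono-≤ (f≤g zero) (∑-mono-≤ (f≤g ∘ suc))

  count-mono : ∀ {n p q} {P : Pred (Fin n) p} {Q : Pred (Fin n) q} (P? : Decidable P) (Q? : Decidable Q) →
               (∀ {i} → P i → Q i) → count (does ∘ P?) ≤ count (does ∘ Q?)
  count-mono {P = P} {Q} P? Q? P⇒Q = ∑-mono-≤ (λ i → indicator-mono (P? i) (Q? i))
    where
    indicator-mono : ∀ {i} (p? : Dec (P i)) (q? : Dec (Q i)) → indicator (does p?) ≤ indicator (does q?)
    indicator-mono (no _)  _       = z≤n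
    indicator-mono (yes _) (yes _) = ≤-refl
    indicator-mono (yes p) (no ¬q) = ⊥-elim (¬q (P⇒Q p))

  count-true : ∀ n → count {n} (λ _ → true) ≡ n
  count-true zero    = refl
  count-true (suc n) = cong suc (count-true n)

  count-split : ∀ {n} (p q : Fin n → Bool) →
                count p ≡ count (λ i → p i ∧ q i) + count (λ i → p i ∧ not (q i))
  count-split p q = trans (sum-cong-≗ (λ i → indicator-split (p i) (q i)))
                          (∑-distrib-+ (λ i → indicator (p i ∧ q i)) (λ i → indicator (p i ∧ not (q i))))
    where
    indicator-split : ∀ x y → indicator x ≡ indicator (x ∧ y) + indicator (x ∧ not y)
    indicator-split false _     = refl
    indicator-split true  true  = refl
    indicator-split true  false = refl

  count-permute : ∀ {n} (p : Fin n → Bool) (π : Permutation′ n) → count (p ∘ (π ⟨$⟩ʳ_)) ≡ count p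
  count-permute p π = sym (∑-permute (indicator ∘ p) π)

  ∑-select : ∀ {k} (j : Fin k) (g : Fin k → Bool) → ∑[ a < k ] indicator (does (j ≟ a) ∧ g a) ≡ indicator (g j)
  ∑-select {suc k} zero    g = trans (cong (indicator (g zero) +_) (sum-replicate-zero k)) (+-identityʳ _)
  ∑-select         (suc j) g = ∑-select j (g ∘ suc)

  count-fibres : ∀ {n k} (m : Fin n → Fin k) (p : Fin k → Fin n → Bool) →
                 ∑[ a < k ] count (λ i → does (m i ≟ a) ∧ p a i) ≡ count (λ i → p (m i) i)
  count-fibres m p = trans (∑-comm (λ a i → indicator (does (m i ≟ a) ∧ p a i)))
                           (sum-cong-≗ (λ i → ∑-select (m i) (λ a → p a i)))

  count-fibres-total : ∀ {n k} (m : Fin n → Fin k) → ∑[ a < k ] count (λ i → does (m i ≟ a)) ≡ n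
  count-fibres-total {n} {k} m = begin
    ∑[ a < k ] count (λ i → does (m i ≟ a))         ≡⟨ sum-cong-≗ {k} (λ a → sum-cong-≗ {n} (λ i → cong indicator (sym (∧-identityʳ _)))) ⟩
    ∑[ a < k ] count (λ i → does (m i ≟ a) ∧ true)  ≡⟨ count-fibres m (λ _ _ → true) ⟩
    count {n} (λ _ → true)                          ≡⟨ count-true n ⟩
    n                                               ∎

module MicroMacro where

  open import Data.Bool using (_∧_; not)
  open import Data.Fin using (Fin; _≟_)
  open import Data.Nat using (ℕ; _≤_; _<_; _<?_; _+_; _*_)
  open import Data.Nat.Properties
    using (<-irrefl; ≮⇒≥; <⇒≱; *-comm; *-distribˡ-+; *-distribʳ-+; +-comm; +-monoʳ-≤; +-cancelˡ-≤; *-monoˡ-≤;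
           +-*-semiring; module ≤-Reasoning)
  open import Algebra.Properties.Semiring.Sum +-*-semiring using (sum-syntax; sum-cong-≗; *-distribˡ-sum; *-distribʳ-sum)
  open import Data.Product using (proj₂)
  open import Function using (id)
  open import Function.Bundles using (mk⤖)
  open import Function.Definitions using (Bijective)
  open import Function.Properties.Bijection using (⤖⇒↔)
  open import Relation.Nullary using (Dec; does; ¬?; _×-dec_)
  open import Relation.Binary.PropositionalEquality using (_≡_; _≢_; refl; sym; trans; cong; cong₂; subst)
  open Counting

  complement-upper-bound : ∀ {P R Q s c l} → P + R ≡ Q → s ≡ c + l → R * s ≤ c * Q → l * Q ≤ P * s
  complement-upper-bound {P} {R} {Q} {s} {c} {l} P+R≡Q s≡c+l Rs≤cQ = +-cancelˡ-≤ (c * Q) (l * Q) (P * s) (begin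
    c * Q + l * Q    ≡⟨ sym (*-distribʳ-+ Q c l) ⟩
    (c + l) * Q      ≡⟨ cong₂ _*_ (sym s≡c+l) (sym P+R≡Q) ⟩
    s * (P + R)      ≡⟨ *-distribˡ-+ s P R ⟩
    s * P + s * R    ≡⟨ cong₂ _+_ (*-comm s P) (*-comm s R) ⟩
    P * s + R * s    ≤⟨ +-monoʳ-≤ (P * s) Rs≤cQ ⟩
    P * s + c * Q    ≡⟨ +-comm (P * s) (c * Q) ⟩
    c * Q + P * s    ∎)
    where open ≤-Reasoning

  module _ {n k : ℕ} (m : Fin n → Fin k) where

    size≡count : ∀ a → size m a ≡ count (λ i → does (m i ≟ a))
    size≡count a = length-filter-tabulate (λ i → m i ≟ a) id

    ∑-size : ∑[ a < k ] size m a ≡ n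
    ∑-size = trans (sum-cong-≗ size≡count) (count-fibres-total m)

    module _ (α : Fin n → Fin n) where

      transCount≡count : ∀ a b → transCount m α a b ≡ count (λ i → does (m i ≟ a) ∧ does (m (α i) ≟ b))
      transCount≡count a b = length-filter-tabulate (λ i → (m i ≟ a) ×-dec (m (α i) ≟ b)) id

      transCount≤size : Bijective _≡_ _≡_ α → ∀ a b → transCount m α a b ≤ size m b
      transCount≤size α-bij a b = begin
        transCount m α a b                                  ≡⟨ transCount≡count a b ⟩
        count (λ i → does (m i ≟ a) ∧ does (m (α i) ≟ b))  ≤⟨ count-mono (λ i → (m i ≟ a) ×-dec (m (α i) ≟ b)) (λ i → m (α i) ≟ b) proj₂ ⟩
        count (λ i → does (m (α i) ≟ b))                    ≡⟨ count-permute (λ j → does (m j ≟ b)) (⤖⇒↔ (mk⤖ α-bij)) ⟩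
        count (λ j → does (m j ≟ b))                        ≡⟨ sym (size≡count b) ⟩
        size m b                                            ∎
        where open ≤-Reasoning

      leaving : Fin k → Fin k → ℕ
      leaving a b = count (λ i → does (m i ≟ a) ∧ not (does (m (α i) ≟ b)))

      size≡transCount+leaving : ∀ a b → size m a ≡ transCount m α a b + leaving a b
      size≡transCount+leaving a b = trans (size≡count a)
        (trans (count-split (λ i → does (m i ≟ a)) (λ i → does (m (α i) ≟ b)))
               (cong (_+ leaving a b) (sym (transCount≡count a b))))

      module _ (t : Fin k → Fin k) where

        offTarget : ℕ
        offTarget = count (λ i → not (does (m (α i) ≟ t (m i))))

        ∑-leaving : ∑[ a < k ] leaving a (t a) ≡ offTarget
        ∑-leaving = count-fibres m (λ a i → not (does (m (α i) ≟ t a)))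

        sizeD≤offTarget : (∀ a → size m a ≤ size m (t a)) → sizeD m α ≤ offTarget
        sizeD≤offTarget size≤size∘t = begin
          sizeD m α                                              ≡⟨ length-filter-tabulate decreases? id ⟩
          count (λ i → does (decreases? i))                      ≤⟨ count-mono decreases? (λ i → ¬? (m (α i) ≟ t (m i))) decreases⇒offTarget ⟩
          offTarget                                              ∎
          where
          open ≤-Reasoning
          decreases? : ∀ i → Dec (size m (m (α i)) < size m (m i))
          decreases? i = size m (m (α i)) <? size m (m i)
          decreases⇒offTarget : ∀ {i} → size m (m (α i)) < size m (m i) → m (α i) ≢ t (m i)
          decreases⇒offTarget {i} decreases onTarget =
            <⇒≱ decreases (subst (λ b → size m (m i) ≤ size m b) (sym onTarget) (size≤size∘t (m i)))

        module _ (α-bij : Bijective _≡_ _≡_ α) {P R Q : ℕ}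
                 (mostlyToTarget : ∀ a → R * size m a ≤ transCount m α a (t a) * Q)
                 (entropyGap : ∀ a b → size m a < size m b → size m a * Q < size m b * R) where

          size≤size∘t : ∀ a → size m a ≤ size m (t a)
          size≤size∘t a = ≮⇒≥ λ shrinks → <-irrefl refl (begin-strict
            size m (t a) * Q            <⟨ entropyGap (t a) a shrinks ⟩
            size m a * R                ≡⟨ *-comm (size m a) R ⟩
            R * size m a                ≤⟨ mostlyToTarget a ⟩
            transCount m α a (t a) * Q  ≤⟨ *-monoˡ-≤ Q (transCount≤size α-bij a (t a)) ⟩
            size m (t a) * Q            ∎)
            where open ≤-Reasoning

          sizeD*Q≤P*n : P + R ≡ Q → sizeD m α * Q ≤ P * n
          sizeD*Q≤P*n P+R≡Q = begin
            sizeD m α * Q                     ≤⟨ *-monoˡ-≤ Q (sizeD≤offTarget size≤size∘t) ⟩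
            offTarget * Q                     ≡⟨ cong (_* Q) (sym ∑-leaving) ⟩
            (∑[ a < k ] leaving a (t a)) * Q  ≡⟨ *-distribʳ-sum Q (λ a → leaving a (t a)) ⟩
            ∑[ a < k ] (leaving a (t a) * Q)  ≤⟨ ∑-mono-≤ leaving-bound ⟩
            ∑[ a < k ] (P * size m a)         ≡⟨ sym (*-distribˡ-sum P (size m)) ⟩
            P * (∑[ a < k ] size m a)         ≡⟨ cong (P *_) ∑-size ⟩
            P * n                             ∎
            where
            open ≤-Reasoning
            leaving-bound : ∀ a → leaving a (t a) * Q ≤ P * size m a
            leaving-bound a = complement-upper-bound {P} {R} {c = transCount m α a (t a)} {l = leaving a (t a)}
              P+R≡Q (size≡transCount+leaving a (t a)) (mostlyToTarget a)

module Fractions where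

  open import Data.Integer as ℤ using (+_; -[1+_])
  import Data.Integer.Properties as ℤ
  open import Data.Integer.Solver using (module +-*-Solver)
  open import Data.Nat as ℕ using (ℕ; zero; suc; z≤n)
  import Data.Nat.Properties as ℕ
  open import Data.Product using (∃₂; _,_)
  open import Data.Rational using (mkℚ; 0ℚ; 1ℚ; _≤_; _<_; _*_; _-_; -_; toℚᵘ; *≤*)
  open import Data.Rational.Properties
    using (toℚᵘ-fromℚᵘ; toℚᵘ-mono-≤; toℚᵘ-cancel-≤; toℚᵘ-mono-<; toℚᵘ-injective;
           toℚᵘ-homo-*; toℚᵘ-homo-+; toℚᵘ-homo‿-; normalize-coprime; normalize-nonNeg; nonNegative⁻¹)
  open import Data.Rational.Unnormalised as ℚᵘ using (mkℚᵘ; _≃_; *≡*)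
  import Data.Rational.Unnormalised.Properties as ℚᵘ
  open import Relation.Binary.PropositionalEquality using (_≡_; refl; sym; trans; cong; cong₂; subst₂; module ≡-Reasoning)

  toℚᵘ-frac : ∀ a b → toℚᵘ (frac a (suc b)) ≃ mkℚᵘ (+ a) b
  toℚᵘ-frac a b = toℚᵘ-fromℚᵘ (mkℚᵘ (+ a) b)

  nonNeg⇒frac : ∀ p → 0ℚ ≤ p → ∃₂ λ a b → p ≡ frac a (suc b)
  nonNeg⇒frac (mkℚ (+ a)    b c) _ = a , b , sym (normalize-coprime c)
  nonNeg⇒frac (mkℚ -[1+ _ ] _ _) (*≤* ())

  frac-*≤* : ∀ a b c d → a ℕ.* suc d ℕ.≤ c ℕ.* b → frac a b ≤ frac c (suc d)
  frac-*≤* a zero    c d _     = nonNegative⁻¹ (frac c (suc d)) {{normalize-nonNeg c (suc d)}}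
  frac-*≤* a (suc b) c d ad≤cb = toℚᵘ-cancel-≤
    (ℚᵘ.≤-respˡ-≃ (ℚᵘ.≃-sym (toℚᵘ-frac a b)) (ℚᵘ.≤-respʳ-≃ (ℚᵘ.≃-sym (toℚᵘ-frac c d))
      (ℚᵘ.*≤* (subst₂ ℤ._≤_ (ℤ.pos-* a (suc d)) (ℤ.pos-* c (suc b)) (ℤ.+≤+ ad≤cb)))))

  frac-drop-*≤* : ∀ a b c d → frac a (suc b) ≤ frac c d → a ℕ.* d ℕ.≤ c ℕ.* suc b
  frac-drop-*≤* a b c zero    _ = ℕ.≤-trans (ℕ.≤-reflexive (ℕ.*-zeroʳ a)) z≤n
  frac-drop-*≤* a b c (suc d) p≤q
    with ℚᵘ.*≤* ad≤cb ← ℚᵘ.≤-respˡ-≃ (toℚᵘ-frac a b) (ℚᵘ.≤-respʳ-≃ (toℚᵘ-frac c d) (toℚᵘ-mono-≤ p≤q))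
    = ℤ.drop‿+≤+ (subst₂ ℤ._≤_ (sym (ℤ.pos-* a (suc d))) (sym (ℤ.pos-* c (suc b))) ad≤cb)

  frac-drop-*<* : ∀ a b c d → frac a (suc b) < frac c (suc d) → a ℕ.* suc d ℕ.< c ℕ.* suc b
  frac-drop-*<* a b c d p<q
    with ℚᵘ.*<* ad<cb ← ℚᵘ.<-respˡ-≃ (toℚᵘ-frac a b) (ℚᵘ.<-respʳ-≃ (toℚᵘ-frac c d) (toℚᵘ-mono-< p<q))
    = ℤ.drop‿+<+ (subst₂ ℤ._<_ (sym (ℤ.pos-* a (suc d))) (sym (ℤ.pos-* c (suc b))) ad<cb)

  ofℕ-*-frac : ∀ a c d → ofℕ a * frac c (suc d) ≡ frac (a ℕ.* c) (suc d)
  ofℕ-*-frac a c d = toℚᵘ-injective (begin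
    toℚᵘ (ofℕ a * frac c (suc d))            ≈⟨ toℚᵘ-homo-* (ofℕ a) (frac c (suc d)) ⟩
    toℚᵘ (ofℕ a) ℚᵘ.* toℚᵘ (frac c (suc d))  ≈⟨ ℚᵘ.*-cong (toℚᵘ-frac a 0) (toℚᵘ-frac c d) ⟩
    mkℚᵘ (+ a ℤ.* + c) (d ℕ.+ 0)             ≡⟨ cong₂ mkℚᵘ (sym (ℤ.pos-* a c)) (ℕ.+-identityʳ d) ⟩
    mkℚᵘ (+ (a ℕ.* c)) d                     ≈⟨ ℚᵘ.≃-sym (toℚᵘ-frac (a ℕ.* c) d) ⟩
    toℚᵘ (frac (a ℕ.* c) (suc d))            ∎)
    where open ℚᵘ.≃-Reasoning

  -- The numerator identity that 1 - P/Q ≃ R/Q unfolds to in ℚᵘ.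
  1-frac-*≡* : ∀ P {R q} → P ℕ.+ R ≡ suc q →
                 (ℤ.1ℤ ℤ.* + suc q ℤ.+ ℤ.- + P ℤ.* ℤ.1ℤ) ℤ.* + suc q ≡ + R ℤ.* + suc (q ℕ.+ 0)
  1-frac-*≡* P {R} {q} P+R≡Q = begin
    (ℤ.1ℤ ℤ.* + suc q ℤ.+ ℤ.- + P ℤ.* ℤ.1ℤ) ℤ.* + suc q
      ≡⟨ cong (λ x → (ℤ.1ℤ ℤ.* x ℤ.+ ℤ.- + P ℤ.* ℤ.1ℤ) ℤ.* x) Q≡P+R ⟩
    (ℤ.1ℤ ℤ.* (+ P ℤ.+ + R) ℤ.+ ℤ.- + P ℤ.* ℤ.1ℤ) ℤ.* (+ P ℤ.+ + R)
      ≡⟨ solve 2 (λ p r → (con ℤ.1ℤ :* (p :+ r) :+ :- p :* con ℤ.1ℤ) :* (p :+ r) := r :* (p :+ r)) refl (+ P) (+ R) ⟩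
    + R ℤ.* (+ P ℤ.+ + R)
      ≡⟨ cong (+ R ℤ.*_) (trans (sym Q≡P+R) (cong (λ x → + suc x) (sym (ℕ.+-identityʳ q)))) ⟩
    + R ℤ.* + suc (q ℕ.+ 0)
      ∎
    where
    open ≡-Reasoning
    open +-*-Solver
    Q≡P+R : + suc q ≡ + P ℤ.+ + R
    Q≡P+R = trans (cong +_ (sym P+R≡Q)) (ℤ.pos-+ P R)

  1-frac : ∀ P {R q} → P ℕ.+ R ≡ suc q → 1ℚ - frac P (suc q) ≡ frac R (suc q)
  1-frac P {R} {q} P+R≡Q = toℚᵘ-injective (begin
    toℚᵘ (1ℚ - frac P (suc q))               ≈⟨ toℚᵘ-homo-+ 1ℚ (- frac P (suc q)) ⟩
    ℚᵘ.1ℚᵘ ℚᵘ.+ toℚᵘ (- frac P (suc q))      ≈⟨ ℚᵘ.+-congʳ ℚᵘ.1ℚᵘ (ℚᵘ.≃-trans (toℚᵘ-homo‿- (frac P (suc q))) (ℚᵘ.-‿cong (toℚᵘ-frac P q))) ⟩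
    ℚᵘ.1ℚᵘ ℚᵘ.- mkℚᵘ (+ P) q                 ≈⟨ *≡* (1-frac-*≡* P P+R≡Q) ⟩
    mkℚᵘ (+ R) q                             ≈⟨ ℚᵘ.≃-sym (toℚᵘ-frac R q) ⟩
    toℚᵘ (frac R (suc q))                    ∎)
    where open ℚᵘ.≃-Reasoning

open import Data.Nat using (ℕ) renaming (_<_ to _<ℕ_)
open import Data.Fin using (Fin)
open import Data.Rational using (ℚ; 0ℚ; 1ℚ; ½; _<_; _≤_; _*_; _-_)
open import Function.Definitions using (Bijective; Surjective)
open import Relation.Binary.PropositionalEquality using (_≡_)

open import Data.Nat using (suc; _+_; _∸_) renaming (_*_ to _*ℕ_; _≤_ to _≤ℕ_)
import Data.Nat.Properties as ℕ
open import Data.Product using (_,_)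
open import Data.Rational.Properties using (<⇒≤)
open import Relation.Binary.PropositionalEquality using (refl; trans; cong; subst)
open MicroMacro using (sizeD*Q≤P*n)
open Fractions

theorem14 : (n k : ℕ) (m : Fin n → Fin k) (α : Fin n → Fin n) →
    Surjective _≡_ _≡_ m → Bijective _≡_ _≡_ α →
    (ε : ℚ) → 0ℚ < ε → ε < ½ →
    (t : Fin k → Fin k) → (∀ a → 1ℚ - ε ≤ transProb m α a (t a)) →
    (∀ a b → size m a <ℕ size m b →
      ofℕ (size m a) < ofℕ (size m b) * (1ℚ - ε)) →
    frac (sizeD m α) n ≤ ε
theorem14 n k m α _ α-bij ε 0<ε ε<½ t 1-ε≤toTarget entropyGap
  with P , q , refl ← nonNeg⇒frac ε (<⇒≤ 0<ε)
  = frac-*≤* (sizeD m α) n P q (sizeD*Q≤P*n m α t α-bij mostlyToTarget entropyGapℕ P+R≡Q)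
  where
  R : ℕ
  R = suc q ∸ P
  P≤Q : P ≤ℕ suc q
  P≤Q = ℕ.≤-trans (ℕ.m≤m*n P 2) (ℕ.<⇒≤ (subst (P *ℕ 2 <ℕ_) (ℕ.*-identityˡ (suc q)) (frac-drop-*<* P q 1 1 ε<½)))
  P+R≡Q : P + R ≡ suc q
  P+R≡Q = ℕ.m+[n∸m]≡n P≤Q
  1-ε≡R/Q : 1ℚ - frac P (suc q) ≡ frac R (suc q)
  1-ε≡R/Q = 1-frac P P+R≡Q
  mostlyToTarget : ∀ a → R *ℕ size m a ≤ℕ transCount m α a (t a) *ℕ suc q
  mostlyToTarget a = frac-drop-*≤* R q (transCount m α a (t a)) (size m a)
    (subst (_≤ transProb m α a (t a)) 1-ε≡R/Q (1-ε≤toTarget a))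
  entropyGapℕ : ∀ a b → size m a <ℕ size m b → size m a *ℕ suc q <ℕ size m b *ℕ R
  entropyGapℕ a b smaller = subst (size m a *ℕ suc q <ℕ_) (ℕ.*-identityʳ (size m b *ℕ R))
    (frac-drop-*<* (size m a) 0 (size m b *ℕ R) q
      (subst (ofℕ (size m a) <_) (trans (cong (ofℕ (size m b) *_) 1-ε≡R/Q) (ofℕ-*-frac (size m b) R q))
        (entropyGap a b smaller)))
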